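{- Let $N=(P,T_1,T_2,W,I)$ be a Petri net game, $M$ a marking, and $\varphi$ a reachability formula over $N$. If $M\not\models\varphi$ and $M\xrightarrow{w}M'$ for some $w\in (T\setminus \mathcal{I}_M(\varphi))^*$, then $M'\not\models\varphi$.
   Context: A Petri net game is $N=(P,T_1,T_2,W,I)$ with finite disjoint sets of places $P$ and transitions $T=T_1\uplus T_2$ (player 1 and player 2 transitions), $W:(P\times T)\cup(T\times P)\to\mathbb{N}_0$ (arc weights) and $I:P\times T\to\mathbb{N}\cup\{\infty\}$ (inhibitor arc weights). A marking is $M:P\to\mathbb{N}_0$. $t$ is enabled in $M$ if $M(p)\ge W(p,t)$ and $M(p)<I(p,t)$ for all $p$, and then $M\xrightarrow{t}M'$ with $M'(p)=M(p)-W(p,t)+W(t,p)$; extend to sequences. $en_i(M)$ is the set of enabled transitions of $T_i$, $en(M)=en_1(M)\cup en_2(M)$. Notation: $^\bullet x=\{y\mid W(y,x)>0\}$, $x^\bullet=\{y\mid W(x,y)>0\}$; ${}^\circ t=\{p\mid I(p,t)\ne\infty\}$; for a place $p$: $^+p=\{t\in{}^\bullet p\mid W(t,p)>W(p,t)\}$, $p^-=\{t\in p^\bullet\mid W(t,p)<W(p,t)\}$; these are extended to sets by union. $\mathit{safe}(M)$: if $en_2(M)=\emptyset$, a transition $t\in en_1(M)$ is in $\mathit{safe}(M)$ iff for every $w\in(T_1\setminus\{t\})^*$ with $M\xrightarrow{w}M_1$, $en_2(M_1)=\emptyset$ and $M\xrightarrow{tw}M_2$, we have $en_2(M_2)=\emptyset$;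 if $en_2(M)\ne\emptyset$ take $\mathit{safe}(M)=\emptyset$. Expressions: $e::=c\mid p\mid e_1+e_2\mid e_1-e_2\mid e_1*e_2$ ($c\in\mathbb{N}_0$, $p\in P$), evaluated in $M$ by $\mathit{eval}_M(c)=c$, $\mathit{eval}_M(p)=M(p)$, and arithmetic. $\mathit{incr}(c)=\mathit{decr}(c)=\emptyset$; $\mathit{incr}(p)={}^+p$, $\mathit{decr}(p)=p^-$; $\mathit{incr}(e_1+e_2)=\mathit{incr}(e_1)\cup\mathit{incr}(e_2)$, $\mathit{decr}(e_1+e_2)=\mathit{decr}(e_1)\cup\mathit{decr}(e_2)$; $\mathit{incr}(e_1-e_2)=\mathit{incr}(e_1)\cup\mathit{decr}(e_2)$, $\mathit{decr}(e_1-e_2)=\mathit{decr}(e_1)\cup\mathit{incr}(e_2)$; $\mathit{incr}(e_1*e_2)=\mathit{decr}(e_1*e_2)=\mathit{incr}(e_1)\cup\mathit{decr}(e_1)\cup\mathit{incr}(e_2)\cup\mathit{decr}(e_2)$. Formulas: $\varphi::=\mathit{true}\mid\mathit{false}\mid t\mid e_1\bowtie e_2\mid\mathit{deadlock}\mid\varphi_1\wedge\varphi_2\mid\varphi_1\vee\varphi_2\mid\neg\varphi$, $\bowtie\in\{<,\le,=,\ne,>,\ge\}$, with $M\models t$ iff $t\in en(M)$, $M\models e_1\bowtie e_2$ iff $\mathit{eval}_M(e_1)\bowtie\mathit{eval}_M(e_2)$, $M\models\mathit{deadlock}$ iff $en(M)=\emptyset$, and the usual Boolean semantics. Interesting transitions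 $\mathcal{I}_M(\varphi)\subseteq T$: if $M\models\varphi$ then $\mathcal{I}_M(\varphi)=\emptyset$; otherwise, recursively: $\mathcal{I}_M(\mathit{deadlock})=\{t\}\cup({}^\bullet t)^-\cup{}^+({}^\circ t)$ for some selected $t\in en(M)$; $\mathcal{I}_M(t)={}^+p$ for some selected $p\in{}^\bullet t$ with $M(p)<W(p,t)$, or $p^-$ for some selected $p\in{}^\circ t$ with $M(p)\ge I(p,t)$; $\mathcal{I}_M(e_1<e_2)=\mathcal{I}_M(e_1\le e_2)=\mathit{decr}(e_1)\cup\mathit{incr}(e_2)$; $\mathcal{I}_M(e_1>e_2)=\mathcal{I}_M(e_1\ge e_2)=\mathit{incr}(e_1)\cup\mathit{decr}(e_2)$; $\mathcal{I}_M(e_1=e_2)$ is $\mathit{decr}(e_1)\cup\mathit{incr}(e_2)$ if $\mathit{eval}_M(e_1)>\mathit{eval}_M(e_2)$ and $\mathit{incr}(e_1)\cup\mathit{decr}(e_2)$ if $\mathit{eval}_M(e_1)<\mathit{eval}_M(e_2)$; $\mathcal{I}_M(e_1\ne e_2)=\mathit{incr}(e_1)\cup\mathit{decr}(e_1)\cup\mathit{incr}(e_2)\cup\mathit{decr}(e_2)$; $\mathcal{I}_M(\varphi_1\vee\varphi_2)=\mathcal{I}_M(\varphi_1)\cup\mathcal{I}_M(\varphi_2)$; $\mathcal{I}_M(\varphi_1\wedge\varphi_2)$ is given by the first applicable case: $\mathcal{I}_M(\varphi_1)$ if $M\models\varphi_2$; $\mathcal{I}_M(\varphi_2)$ if $M\models\varphi_1$;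 $\mathcal{I}_M(\varphi_1)$ if $M\not\models\varphi_1$ and $\mathcal{I}_M(\varphi_1)\subseteq\mathit{safe}(M)$; $\mathcal{I}_M(\varphi_2)$ if $M\not\models\varphi_2$ and $\mathcal{I}_M(\varphi_2)\subseteq\mathit{safe}(M)$; otherwise $\mathcal{I}_M(\varphi_i)$ for some selected $i\in\{1,2\}$. Negations: $\mathcal{I}_M(\neg\mathit{deadlock})=\emptyset$; $\mathcal{I}_M(\neg t)=({}^\bullet t)^-\cup{}^+({}^\circ t)$; $\mathcal{I}_M(\neg(e_1<e_2))=\mathcal{I}_M(e_1\ge e_2)$, $\mathcal{I}_M(\neg(e_1\le e_2))=\mathcal{I}_M(e_1>e_2)$, $\mathcal{I}_M(\neg(e_1>e_2))=\mathcal{I}_M(e_1\le e_2)$, $\mathcal{I}_M(\neg(e_1\ge e_2))=\mathcal{I}_M(e_1<e_2)$, $\mathcal{I}_M(\neg(e_1=e_2))=\mathcal{I}_M(e_1\ne e_2)$, $\mathcal{I}_M(\neg(e_1\ne e_2))=\mathcal{I}_M(e_1=e_2)$; $\mathcal{I}_M(\neg(\varphi_1\wedge\varphi_2))=\mathcal{I}_M(\neg\varphi_1\vee\neg\varphi_2)$, $\mathcal{I}_M(\neg(\varphi_1\vee\varphi_2))=\mathcal{I}_M(\neg\varphi_1\wedge\neg\varphi_2)$. For the cases not listed in the paper we take $\mathcal{I}_M(\mathit{false})=\mathcal{I}_M(\neg\mathit{true})=\emptyset$ and $\mathcal{I}_M(\neg\neg\varphi)=\mathcal{I}_M(\varphi)$.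 Any choices of the "selected" items are allowed. -}

module Defs where

open import Data.Nat using (ℕ; _≤_; _<_; _∸_; _+_)
open import Data.Integer as ℤ using (ℤ; +_)
open import Data.Fin using (Fin)
open import Data.Maybe using (Maybe; just; nothing)
open import Data.List using (List; []; _∷_)
open import Data.List.Relation.Unary.All using (All)
open import Data.Product using (Σ; _×_; ∃)
open import Data.Sum using (_⊎_)
open import Data.Empty using (⊥)
open import Data.Unit using (⊤)
open import Relation.Nullary using (¬_)
open import Relation.Binary.PropositionalEquality using (_≡_; _≢_)

data Player : Set where
  player1 player2 : Player

-- Places are Fin np, transitions are Fin nt. The partition T = T1 ⊎ T2
-- is given by the owner function. Inhibitor weights: nothing = ∞.
record Game : Set where
  field
    np nt  : ℕ
    owner  : Fin nt → Player
    Wpt    : Fin np → Fin nt → ℕ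
    Wtp    : Fin nt → Fin np → ℕ
    Inh    : Fin np → Fin nt → Maybe ℕ
    Inh-pos : ∀ p t n → Inh p t ≡ just n → 1 ≤ n   -- ℕ = {1,2,...}

module _ (N : Game) where
  open Game N

  Place Trans : Set
  Place = Fin np
  Trans = Fin nt

  Marking : Set
  Marking = Place → ℕ

  TSet : Set₁
  TSet = Trans → Set

  ∅ : TSet
  ∅ _ = ⊥

  _∪_ : TSet → TSet → TSet
  (A ∪ B) t = A t ⊎ B t

  _⊆_ : TSet → TSet → Set
  A ⊆ B = ∀ t → A t → B t

  IsT1 IsT2 : Trans → Set
  IsT1 t = owner t ≡ player1
  IsT2 t = owner t ≡ player2

  BelowInh : ℕ → Maybe ℕ → Set
  BelowInh m nothing  = ⊤
  BelowInh m (just n) = m < n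

  Enabled : Marking → Trans → Set
  Enabled M t = ∀ p → Wpt p t ≤ M p × BelowInh (M p) (Inh p t)

  fire : Marking → Trans → Marking
  fire M t p = M p ∸ Wpt p t + Wtp t p

  data Steps : Marking → List Trans → Marking → Set where
    done : ∀ {M} → Steps M [] M
    step : ∀ {M t w M'} → Enabled M t → Steps (fire M t) w M' → Steps M (t ∷ w) M'

  En2Empty : Marking → Set
  En2Empty M = ∀ t → IsT2 t → ¬ Enabled M t

  Safe : Marking → TSet
  Safe M t =
    En2Empty M × IsT1 t × Enabled M t ×
    (∀ w M₁ M₂ → All (λ u → IsT1 u × u ≢ t) w →
       Steps M w M₁ → En2Empty M₁ → Steps M (t ∷ w) M₂ → En2Empty M₂)

  plusP : Place → TSet
  plusP p t = Wpt p t < Wtp t p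
  minusP : Place → TSet
  minusP p t = Wtp t p < Wpt p t

  preMinus : Trans → TSet
  preMinus t u = Σ Place λ p → (0 < Wpt p t) × minusP p u
  plusInh : Trans → TSet
  plusInh t u = Σ Place λ p → (Inh p t ≢ nothing) × plusP p u

  data Expr : Set where
    const : ℕ → Expr
    place : Place → Expr
    _⊕_ _⊖_ _⊛_ : Expr → Expr → Expr

  eval : Marking → Expr → ℤ
  eval M (const c) = + c
  eval M (place p) = + (M p)
  eval M (e₁ ⊕ e₂) = eval M e₁ ℤ.+ eval M e₂
  eval M (e₁ ⊖ e₂) = eval M e₁ ℤ.- eval M e₂
  eval M (e₁ ⊛ e₂) = eval M e₁ ℤ.* eval M e₂

  incr decr : Expr → TSet
  incr (const c) = ∅
  incr (place p) = plusP p
  incr (e₁ ⊕ e₂) = incr e₁ ∪ incr e₂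
  incr (e₁ ⊖ e₂) = incr e₁ ∪ decr e₂
  incr (e₁ ⊛ e₂) = (incr e₁ ∪ decr e₁) ∪ (incr e₂ ∪ decr e₂)
  decr (const c) = ∅
  decr (place p) = minusP p
  decr (e₁ ⊕ e₂) = decr e₁ ∪ decr e₂
  decr (e₁ ⊖ e₂) = decr e₁ ∪ incr e₂
  decr (e₁ ⊛ e₂) = (incr e₁ ∪ decr e₁) ∪ (incr e₂ ∪ decr e₂)

  data Op : Set where
    lt le eq ne gt ge : Op

  evalOp : Op → ℤ → ℤ → Set
  evalOp lt a b = a ℤ.< b
  evalOp le a b = a ℤ.≤ b
  evalOp eq a b = a ≡ b
  evalOp ne a b = a ≢ b
  evalOp gt a b = b ℤ.< a
  evalOp ge a b = b ℤ.≤ a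

  negOp : Op → Op
  negOp lt = ge
  negOp le = gt
  negOp eq = ne
  negOp ne = eq
  negOp gt = le
  negOp ge = lt

  data Formula : Set where
    tt ff     : Formula
    fireable  : Trans → Formula
    cmp       : Op → Expr → Expr → Formula
    deadlock  : Formula
    _∧'_ _∨'_ : Formula → Formula → Formula
    neg       : Formula → Formula

  _⊨_ : Marking → Formula → Set
  M ⊨ tt = ⊤
  M ⊨ ff = ⊥
  M ⊨ fireable t = Enabled M t
  M ⊨ cmp o e₁ e₂ = evalOp o (eval M e₁) (eval M e₂)
  M ⊨ deadlock = ∀ t → ¬ Enabled M t
  M ⊨ (φ ∧' ψ) = (M ⊨ φ) × (M ⊨ ψ)
  M ⊨ (φ ∨' ψ) = (M ⊨ φ) ⊎ (M ⊨ ψ)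
  M ⊨ neg φ = ¬ (M ⊨ φ)

  -- Interesting transitions.  Interesting M φ S means: S is a possible
  -- value of 𝓘_M(φ) for some choice of the "selected" items.

  data Interesting (M : Marking) : Formula → TSet → Set₁ where
    sat : ∀ {φ} → M ⊨ φ → Interesting M φ ∅
    false-i : ¬ (M ⊨ ff) → Interesting M ff ∅
    deadlock-i : ∀ t → ¬ (M ⊨ deadlock) → Enabled M t →
      Interesting M deadlock ((λ u → u ≡ t) ∪ (preMinus t ∪ plusInh t))
    fire-pre : ∀ t p → ¬ (M ⊨ fireable t) → 0 < Wpt p t → M p < Wpt p t →
      Interesting M (fireable t) (plusP p)
    fire-inh : ∀ t p n → ¬ (M ⊨ fireable t) → Inh p t ≡ just n → n ≤ M p →
      Interesting M (fireable t) (minusP p)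
    lt-i : ∀ e₁ e₂ → ¬ (M ⊨ cmp lt e₁ e₂) → Interesting M (cmp lt e₁ e₂) (decr e₁ ∪ incr e₂)
    le-i : ∀ e₁ e₂ → ¬ (M ⊨ cmp le e₁ e₂) → Interesting M (cmp le e₁ e₂) (decr e₁ ∪ incr e₂)
    gt-i : ∀ e₁ e₂ → ¬ (M ⊨ cmp gt e₁ e₂) → Interesting M (cmp gt e₁ e₂) (incr e₁ ∪ decr e₂)
    ge-i : ∀ e₁ e₂ → ¬ (M ⊨ cmp ge e₁ e₂) → Interesting M (cmp ge e₁ e₂) (incr e₁ ∪ decr e₂)
    eq-gt : ∀ e₁ e₂ → ¬ (M ⊨ cmp eq e₁ e₂) → eval M e₂ ℤ.< eval M e₁ →
      Interesting M (cmp eq e₁ e₂) (decr e₁ ∪ incr e₂)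
    eq-lt : ∀ e₁ e₂ → ¬ (M ⊨ cmp eq e₁ e₂) → eval M e₁ ℤ.< eval M e₂ →
      Interesting M (cmp eq e₁ e₂) (incr e₁ ∪ decr e₂)
    ne-i : ∀ e₁ e₂ → ¬ (M ⊨ cmp ne e₁ e₂) →
      Interesting M (cmp ne e₁ e₂) ((incr e₁ ∪ decr e₁) ∪ (incr e₂ ∪ decr e₂))
    or-i : ∀ {φ₁ φ₂ S₁ S₂} → ¬ (M ⊨ (φ₁ ∨' φ₂)) →
      Interesting M φ₁ S₁ → Interesting M φ₂ S₂ → Interesting M (φ₁ ∨' φ₂) (S₁ ∪ S₂)
    and-1 : ∀ {φ₁ φ₂ S₁ S₂} → ¬ (M ⊨ (φ₁ ∧' φ₂)) →
      Interesting M φ₁ S₁ → Interesting M φ₂ S₂ →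
      M ⊨ φ₂ → Interesting M (φ₁ ∧' φ₂) S₁
    and-2 : ∀ {φ₁ φ₂ S₁ S₂} → ¬ (M ⊨ (φ₁ ∧' φ₂)) →
      Interesting M φ₁ S₁ → Interesting M φ₂ S₂ →
      ¬ (M ⊨ φ₂) → M ⊨ φ₁ → Interesting M (φ₁ ∧' φ₂) S₂
    and-3 : ∀ {φ₁ φ₂ S₁ S₂} → ¬ (M ⊨ (φ₁ ∧' φ₂)) →
      Interesting M φ₁ S₁ → Interesting M φ₂ S₂ →
      ¬ (M ⊨ φ₂) → ¬ (M ⊨ φ₁) → S₁ ⊆ Safe M → Interesting M (φ₁ ∧' φ₂) S₁
    and-4 : ∀ {φ₁ φ₂ S₁ S₂} → ¬ (M ⊨ (φ₁ ∧' φ₂)) →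
      Interesting M φ₁ S₁ → Interesting M φ₂ S₂ →
      ¬ (M ⊨ φ₂) → ¬ (M ⊨ φ₁) → ¬ (S₁ ⊆ Safe M) → S₂ ⊆ Safe M →
      Interesting M (φ₁ ∧' φ₂) S₂
    and-5₁ : ∀ {φ₁ φ₂ S₁ S₂} → ¬ (M ⊨ (φ₁ ∧' φ₂)) →
      Interesting M φ₁ S₁ → Interesting M φ₂ S₂ →
      ¬ (M ⊨ φ₂) → ¬ (M ⊨ φ₁) → ¬ (S₁ ⊆ Safe M) → ¬ (S₂ ⊆ Safe M) →
      Interesting M (φ₁ ∧' φ₂) S₁
    and-5₂ : ∀ {φ₁ φ₂ S₁ S₂} → ¬ (M ⊨ (φ₁ ∧' φ₂)) →
      Interesting M φ₁ S₁ → Interesting M φ₂ S₂ →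
      ¬ (M ⊨ φ₂) → ¬ (M ⊨ φ₁) → ¬ (S₁ ⊆ Safe M) → ¬ (S₂ ⊆ Safe M) →
      Interesting M (φ₁ ∧' φ₂) S₂
    not-tt : ¬ (M ⊨ neg tt) → Interesting M (neg tt) ∅
    not-deadlock : ¬ (M ⊨ neg deadlock) → Interesting M (neg deadlock) ∅
    not-fire : ∀ t → ¬ (M ⊨ neg (fireable t)) →
      Interesting M (neg (fireable t)) (preMinus t ∪ plusInh t)
    not-cmp : ∀ {o e₁ e₂ S} → ¬ (M ⊨ neg (cmp o e₁ e₂)) →
      Interesting M (cmp (negOp o) e₁ e₂) S → Interesting M (neg (cmp o e₁ e₂)) S
    not-and : ∀ {φ₁ φ₂ S} → ¬ (M ⊨ neg (φ₁ ∧' φ₂)) →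
      Interesting M (neg φ₁ ∨' neg φ₂) S → Interesting M (neg (φ₁ ∧' φ₂)) S
    not-or : ∀ {φ₁ φ₂ S} → ¬ (M ⊨ neg (φ₁ ∨' φ₂)) →
      Interesting M (neg φ₁ ∧' neg φ₂) S → Interesting M (neg (φ₁ ∨' φ₂)) S
    not-not : ∀ {φ S} → ¬ (M ⊨ neg (neg φ)) →
      Interesting M φ S → Interesting M (neg (neg φ)) S

-- The proof rests on one notion: a property Q of markings is an invariant
-- outside a set S of transitions if firing any enabled transition not in S
-- preserves Q; such a Q then holds along every run avoiding S.  We show:
--   * per place: outside ⁺p the token count of p does not grow, outside
--     p⁻ it does not shrink; lifted to expressions, eval e does not grow
--     outside incr e and does not shrink outside decr e;
--   * hence comparisons lo ≤ hi, lo < hi and e = f are invariants outside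
--     the corresponding incr/decr sets, and enabledness of t is an
--     invariant outside (•t)⁻ ∪ ⁺(°t);
--   * each atomic clause of 𝓘_M(φ) picks exactly the transitions that can
--     destroy a witness of ¬φ, so the witness is invariant along the run.
-- The theorem follows by induction on the derivation of 𝓘_M(φ) = S: the
-- Boolean clauses only pass to subformulas, shrinking S where needed.
module Submission where

open import Defs
open import Data.List using (List)
open import Data.List.Relation.Unary.All using (All; []; _∷_)
import Data.List.Relation.Unary.All as All
open import Relation.Nullary using (¬_; yes; no)
open import Relation.Nullary.Negation using (contradiction; contraposition; negated-stable; _¬-⊎_)
open import Data.Nat as ℕ using (_∸_; z≤n)
import Data.Nat.Properties as ℕP
open import Data.Integer as ℤ using (+≤+)
import Data.Integer.Properties as ℤP
open import Data.Maybe using (just; nothing)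
open import Data.Product using (_×_; _,_; proj₁; proj₂; uncurry)
open import Data.Sum using (_⊎_; inj₁; inj₂; swap)
open import Data.Empty using (⊥; ⊥-elim)
open import Data.Unit using (tt)
open import Relation.Binary.PropositionalEquality using (_≡_; sym; trans; cong₂; subst)

-- Firing t replaces m tokens by m ∸ a + b where a = W(p,t) ≤ m and b = W(t,p):
-- the count does not grow if b ≤ a and does not shrink if a ≤ b.
∸+-≤ : ∀ m a b → a ℕ.≤ m → b ℕ.≤ a → m ∸ a ℕ.+ b ℕ.≤ m
∸+-≤ m a b a≤m b≤a = ℕP.≤-trans (ℕP.+-monoʳ-≤ (m ∸ a) b≤a) (ℕP.≤-reflexive (ℕP.m∸n+n≡m a≤m))

∸+-≥ : ∀ m a b → a ℕ.≤ m → a ℕ.≤ b → m ℕ.≤ m ∸ a ℕ.+ b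
∸+-≥ m a b a≤m a≤b = ℕP.≤-trans (ℕP.≤-reflexive (sym (ℕP.m∸n+n≡m a≤m))) (ℕP.+-monoʳ-≤ (m ∸ a) a≤b)

-- The constructively valid De Morgan directions needed for negated
-- conjunctions and disjunctions.
¬⊎¬⇒¬× : {A B : Set} → ¬ A ⊎ ¬ B → ¬ (A × B)
¬⊎¬⇒¬× (inj₁ ¬a) (a , _) = ¬a a
¬⊎¬⇒¬× (inj₂ ¬b) (_ , b) = ¬b b

¬[¬⊎¬]⇒¬¬× : {A B : Set} → ¬ (¬ A ⊎ ¬ B) → ¬ ¬ (A × B)
¬[¬⊎¬]⇒¬¬× k ¬ab = k (inj₁ (λ a → k (inj₂ (λ b → ¬ab (a , b)))))

¬[¬×¬]⇒¬¬⊎ : {A B : Set} → ¬ (¬ A × ¬ B) → ¬ ¬ (A ⊎ B)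
¬[¬×¬]⇒¬¬⊎ k ¬a⊎b = k ((λ a → ¬a⊎b (inj₁ a)) , (λ b → ¬a⊎b (inj₂ b)))

module _ (N : Game) where
  open Game N

  Avoiding : TSet N → List (Trans N) → Set
  Avoiding S = All (λ t → ¬ S t)

  avoiding-⊆ : ∀ {A S w} → _⊆_ N A S → Avoiding S w → Avoiding A w
  avoiding-⊆ A⊆S = All.map (λ t∉S t∈A → t∉S (A⊆S _ t∈A))

  Invariant : TSet N → (Marking N → Set) → Set
  Invariant S Q = ∀ M t → ¬ S t → Enabled N M t → Q M → Q (fire N M t)

  invariant-⊆ : ∀ {A S Q} → _⊆_ N A S → Invariant A Q → Invariant S Q
  invariant-⊆ A⊆S inv M t t∉S = inv M t (λ t∈A → t∉S (A⊆S t t∈A))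

  invariant-along : ∀ {S Q M w M'} → Invariant S Q →
    Avoiding S w → Steps N M w M' → Q M → Q M'
  invariant-along inv []           done             q = q
  invariant-along inv (t∉S ∷ w∉S) (step enₜ steps) q =
    invariant-along inv w∉S steps (inv _ _ t∉S enₜ q)

  ¬¬-invariant : ∀ {S Q} → Invariant S Q → Invariant S (λ M → ¬ ¬ Q M)
  ¬¬-invariant inv M t t∉S enₜ ¬¬q ¬q′ = ¬¬q (λ q → ¬q′ (inv M t t∉S enₜ q))

  fire-≤ : ∀ {M t} p → Enabled N M t → ¬ plusP N p t → fire N M t p ℕ.≤ M p
  fire-≤ {M} {t} p enₜ t∉⁺p = ∸+-≤ (M p) (Wpt p t) (Wtp t p) (proj₁ (enₜ p)) (ℕP.≮⇒≥ t∉⁺p)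

  fire-≥ : ∀ {M t} p → Enabled N M t → ¬ minusP N p t → M p ℕ.≤ fire N M t p
  fire-≥ {M} {t} p enₜ t∉p⁻ = ∸+-≥ (M p) (Wpt p t) (Wtp t p) (proj₁ (enₜ p)) (ℕP.≮⇒≥ t∉p⁻)

  below-invariant : ∀ p k → Invariant (plusP N p) (λ M → M p ℕ.< k)
  below-invariant p k M t t∉⁺p enₜ Mp<k = ℕP.≤-<-trans (fire-≤ p enₜ t∉⁺p) Mp<k

  above-invariant : ∀ p k → Invariant (minusP N p) (λ M → k ℕ.≤ M p)
  above-invariant p k M t t∉p⁻ enₜ k≤Mp = ℕP.≤-trans k≤Mp (fire-≥ p enₜ t∉p⁻)

  -- Lifted to expressions: eval e does not grow outside incr e and does not
  -- shrink outside decr e; a product needs both factors unchanged.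
  eval-≤ : ∀ e {M t} → Enabled N M t → ¬ incr N e t → eval N (fire N M t) e ℤ.≤ eval N M e
  eval-≥ : ∀ e {M t} → Enabled N M t → ¬ decr N e t → eval N M e ℤ.≤ eval N (fire N M t) e

  eval-≡ : ∀ e {M t} → Enabled N M t → ¬ incr N e t → ¬ decr N e t →
    eval N (fire N M t) e ≡ eval N M e
  eval-≡ e enₜ t∉incr t∉decr = ℤP.≤-antisym (eval-≤ e enₜ t∉incr) (eval-≥ e enₜ t∉decr)

  eval-⊛-≡ : ∀ e₁ e₂ {M t} → Enabled N M t → ¬ incr N (e₁ ⊛ e₂) t →
    eval N (fire N M t) (e₁ ⊛ e₂) ≡ eval N M (e₁ ⊛ e₂)
  eval-⊛-≡ e₁ e₂ enₜ t∉ = cong₂ ℤ._*_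
    (eval-≡ e₁ enₜ (λ x → t∉ (inj₁ (inj₁ x))) (λ x → t∉ (inj₁ (inj₂ x))))
    (eval-≡ e₂ enₜ (λ x → t∉ (inj₂ (inj₁ x))) (λ x → t∉ (inj₂ (inj₂ x))))

  eval-≤ (const c) enₜ t∉ = ℤP.≤-refl
  eval-≤ (place p) enₜ t∉ = +≤+ (fire-≤ p enₜ t∉)
  eval-≤ (e₁ ⊕ e₂) enₜ t∉ =
    ℤP.+-mono-≤ (eval-≤ e₁ enₜ (λ x → t∉ (inj₁ x))) (eval-≤ e₂ enₜ (λ x → t∉ (inj₂ x)))
  eval-≤ (e₁ ⊖ e₂) enₜ t∉ =
    ℤP.+-mono-≤ (eval-≤ e₁ enₜ (λ x → t∉ (inj₁ x))) (ℤP.neg-mono-≤ (eval-≥ e₂ enₜ (λ x → t∉ (inj₂ x))))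
  eval-≤ (e₁ ⊛ e₂) enₜ t∉ = ℤP.≤-reflexive (eval-⊛-≡ e₁ e₂ enₜ t∉)

  eval-≥ (const c) enₜ t∉ = ℤP.≤-refl
  eval-≥ (place p) enₜ t∉ = +≤+ (fire-≥ p enₜ t∉)
  eval-≥ (e₁ ⊕ e₂) enₜ t∉ =
    ℤP.+-mono-≤ (eval-≥ e₁ enₜ (λ x → t∉ (inj₁ x))) (eval-≥ e₂ enₜ (λ x → t∉ (inj₂ x)))
  eval-≥ (e₁ ⊖ e₂) enₜ t∉ =
    ℤP.+-mono-≤ (eval-≥ e₁ enₜ (λ x → t∉ (inj₁ x))) (ℤP.neg-mono-≤ (eval-≤ e₂ enₜ (λ x → t∉ (inj₂ x))))
  eval-≥ (e₁ ⊛ e₂) enₜ t∉ = ℤP.≤-reflexive (sym (eval-⊛-≡ e₁ e₂ enₜ t∉))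

  -- Comparisons are invariant when the larger side cannot shrink and the
  -- smaller side cannot grow; equality when neither side can change.
  ≤-invariant : ∀ lo hi → Invariant (_∪_ N (decr N hi) (incr N lo)) (λ M → eval N M lo ℤ.≤ eval N M hi)
  ≤-invariant lo hi M t t∉ enₜ lo≤hi =
    ℤP.≤-trans (eval-≤ lo enₜ (λ x → t∉ (inj₂ x)))
      (ℤP.≤-trans lo≤hi (eval-≥ hi enₜ (λ x → t∉ (inj₁ x))))

  <-invariant : ∀ lo hi → Invariant (_∪_ N (decr N hi) (incr N lo)) (λ M → eval N M lo ℤ.< eval N M hi)
  <-invariant lo hi M t t∉ enₜ lo<hi =
    ℤP.≤-<-trans (eval-≤ lo enₜ (λ x → t∉ (inj₂ x)))
      (ℤP.<-≤-trans lo<hi (eval-≥ hi enₜ (λ x → t∉ (inj₁ x))))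

  ≡-invariant : ∀ e f →
    Invariant (_∪_ N (_∪_ N (incr N e) (decr N e)) (_∪_ N (incr N f) (decr N f)))
              (λ M → eval N M e ≡ eval N M f)
  ≡-invariant e f M t t∉ enₜ e≡f = trans
    (eval-≡ e enₜ (λ x → t∉ (inj₁ (inj₁ x))) (λ x → t∉ (inj₁ (inj₂ x))))
    (trans e≡f (sym (eval-≡ f enₜ (λ x → t∉ (inj₂ (inj₁ x))) (λ x → t∉ (inj₂ (inj₂ x))))))

  -- Enabledness of t survives transitions outside (•t)⁻ ∪ ⁺(°t): the
  -- preconditions of t cannot lose tokens and its inhibitors cannot gain any.
  enabled-invariant : ∀ t → Invariant (_∪_ N (preMinus N t) (plusInh N t)) (λ M → Enabled N M t)
  enabled-invariant t M u u∉ enᵤ enₜ p = pre-kept , inh-kept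
    where
      pre-kept : Wpt p t ℕ.≤ fire N M u p
      pre-kept with 0 ℕ.<? Wpt p t
      ... | yes p∈•t = ℕP.≤-trans (proj₁ (enₜ p)) (fire-≥ p enᵤ (λ u∈p⁻ → u∉ (inj₁ (p , p∈•t , u∈p⁻))))
      ... | no  p∉•t = ℕP.≤-trans (ℕP.≮⇒≥ p∉•t) z≤n

      inh-kept : BelowInh N (fire N M u p) (Inh p t)
      inh-kept with Inh p t in inh≡ | proj₂ (enₜ p)
      ... | nothing | _     = tt
      ... | just n  | Mp<n  = ℕP.≤-<-trans (fire-≤ p enᵤ u∉⁺p) Mp<n
        where
          p∈°t : Inh p t ≡ nothing → ⊥
          p∈°t inh≡nothing with trans (sym inh≡) inh≡nothing
          ... | ()
          u∉⁺p : ¬ plusP N p u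
          u∉⁺p u∈⁺p = u∉ (inj₂ (p , p∈°t , u∈⁺p))

  negOp-sound : ∀ o a b → evalOp N (negOp N o) a b → ¬ evalOp N o a b
  negOp-sound lt a b = ℤP.≤⇒≯
  negOp-sound le a b = ℤP.<⇒≱
  negOp-sound eq a b a≢b = a≢b
  negOp-sound ne a b a≡b a≢b = a≢b a≡b
  negOp-sound gt a b = ℤP.≤⇒≯
  negOp-sound ge a b = ℤP.<⇒≱

  negOp-complete : ∀ o a b → ¬ evalOp N o a b → evalOp N (negOp N o) a b
  negOp-complete lt a b = ℤP.≮⇒≥
  negOp-complete le a b = ℤP.≰⇒>
  negOp-complete eq a b a≢b = a≢b
  negOp-complete ne a b ¬a≢b with a ℤP.≟ b
  ... | yes a≡b = a≡b
  ... | no  a≢b = ⊥-elim (¬a≢b a≢b)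
  negOp-complete gt a b = ℤP.≮⇒≥
  negOp-complete ge a b = ℤP.≰⇒>

  Persists : Marking N → Formula N → TSet N → Set
  Persists M φ S = ∀ {w M'} → Avoiding S w → Steps N M w M' → ¬ (_⊨_ N M' φ)

  -- Atomic clauses: the chosen transitions are the only ones able to
  -- destroy the witness of ¬φ, which is therefore invariant along the run.
  deadlock-persists : ∀ {M S} → Interesting N M deadlock S → ¬ (_⊨_ N M deadlock) →
    Persists M deadlock S
  deadlock-persists (sat dead) ¬dead = ⊥-elim (¬dead dead)
  deadlock-persists (deadlock-i t _ enₜ) _ avoid steps dead =
    dead t (invariant-along (invariant-⊆ (λ _ → inj₂) (enabled-invariant t)) avoid steps enₜ)

  fireable-persists : ∀ {M t S} → Interesting N M (fireable t) S → ¬ (_⊨_ N M (fireable t)) →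
    Persists M (fireable t) S
  fireable-persists (sat enₜ) ¬enₜ = ⊥-elim (¬enₜ enₜ)
  fireable-persists (fire-pre t p _ _ Mp<W) _ avoid steps enₜ =
    ℕP.<⇒≱ (invariant-along (below-invariant p (Wpt p t)) avoid steps Mp<W) (proj₁ (enₜ p))
  fireable-persists (fire-inh t p n _ inh≡n n≤Mp) _ {M' = M'} avoid steps enₜ =
    ℕP.<⇒≱ (subst (BelowInh N (M' p)) inh≡n (proj₂ (enₜ p)))
      (invariant-along (above-invariant p n) avoid steps n≤Mp)

  cmp-persists : ∀ {M o e₁ e₂ S} → Interesting N M (cmp o e₁ e₂) S → ¬ (_⊨_ N M (cmp o e₁ e₂)) →
    Persists M (cmp o e₁ e₂) S
  cmp-persists (sat holds) ¬holds = ⊥-elim (¬holds holds)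
  cmp-persists (lt-i e₁ e₂ ¬lt) _ avoid steps =
    ℤP.≤⇒≯ (invariant-along (≤-invariant e₂ e₁) avoid steps (ℤP.≮⇒≥ ¬lt))
  cmp-persists (le-i e₁ e₂ ¬le) _ avoid steps =
    ℤP.<⇒≱ (invariant-along (<-invariant e₂ e₁) avoid steps (ℤP.≰⇒> ¬le))
  cmp-persists (gt-i e₁ e₂ ¬gt) _ avoid steps =
    ℤP.≤⇒≯ (invariant-along (invariant-⊆ (λ _ → swap) (≤-invariant e₁ e₂)) avoid steps (ℤP.≮⇒≥ ¬gt))
  cmp-persists (ge-i e₁ e₂ ¬ge) _ avoid steps =
    ℤP.<⇒≱ (invariant-along (invariant-⊆ (λ _ → swap) (<-invariant e₁ e₂)) avoid steps (ℤP.≰⇒> ¬ge))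
  cmp-persists (eq-gt e₁ e₂ _ e₂<e₁) _ avoid steps e₁≡e₂ =
    ℤP.<⇒≢ (invariant-along (<-invariant e₂ e₁) avoid steps e₂<e₁) (sym e₁≡e₂)
  cmp-persists (eq-lt e₁ e₂ _ e₁<e₂) _ avoid steps =
    ℤP.<⇒≢ (invariant-along (invariant-⊆ (λ _ → swap) (<-invariant e₁ e₂)) avoid steps e₁<e₂)
  cmp-persists (ne-i e₁ e₂ ¬ne) _ avoid steps e₁≢e₂ =
    e₁≢e₂ (invariant-along (≡-invariant e₁ e₂) avoid steps (negOp-complete ne _ _ ¬ne))

  persists : ∀ {M φ S} → Interesting N M φ S → ¬ (_⊨_ N M φ) → Persists M φ S
  persists (sat holds) ¬holds = ⊥-elim (¬holds holds)
  persists (false-i _) _ _ _ ()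
  persists i@(deadlock-i _ _ _) = deadlock-persists i
  persists i@(fire-pre _ _ _ _ _) = fireable-persists i
  persists i@(fire-inh _ _ _ _ _ _) = fireable-persists i
  persists i@(lt-i _ _ _) = cmp-persists i
  persists i@(le-i _ _ _) = cmp-persists i
  persists i@(gt-i _ _ _) = cmp-persists i
  persists i@(ge-i _ _ _) = cmp-persists i
  persists i@(eq-gt _ _ _ _) = cmp-persists i
  persists i@(eq-lt _ _ _ _) = cmp-persists i
  persists i@(ne-i _ _ _) = cmp-persists i
  persists (or-i ¬φ₁∨φ₂ i₁ i₂) _ avoid steps (inj₁ φ₁) =
    persists i₁ (λ h → ¬φ₁∨φ₂ (inj₁ h)) (avoiding-⊆ (λ _ → inj₁) avoid) steps φ₁
  persists (or-i ¬φ₁∨φ₂ i₁ i₂) _ avoid steps (inj₂ φ₂) =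
    persists i₂ (λ h → ¬φ₁∨φ₂ (inj₂ h)) (avoiding-⊆ (λ _ → inj₂) avoid) steps φ₂
  persists (and-1 ¬φ₁∧φ₂ i₁ _ φ₂) _ avoid steps (h₁ , _) = persists i₁ (λ h → ¬φ₁∧φ₂ (h , φ₂)) avoid steps h₁
  persists (and-2 _ _ i₂ ¬φ₂ _) _ avoid steps (_ , h₂) = persists i₂ ¬φ₂ avoid steps h₂
  persists (and-3 _ i₁ _ _ ¬φ₁ _) _ avoid steps (h₁ , _) = persists i₁ ¬φ₁ avoid steps h₁
  persists (and-4 _ _ i₂ ¬φ₂ _ _ _) _ avoid steps (_ , h₂) = persists i₂ ¬φ₂ avoid steps h₂
  persists (and-5₁ _ i₁ _ _ ¬φ₁ _ _) _ avoid steps (h₁ , _) = persists i₁ ¬φ₁ avoid steps h₁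
  persists (and-5₂ _ _ i₂ ¬φ₂ _ _ _) _ avoid steps (_ , h₂) = persists i₂ ¬φ₂ avoid steps h₂
  persists (not-tt _) _ _ _ ¬true = ¬true tt
  -- M is a deadlock, so the only run from M is the empty one.
  persists (not-deadlock _) ¬¬dead _ done = ¬¬dead
  persists (not-deadlock _) ¬¬dead _ (step enₜ _) = ⊥-elim (¬¬dead (λ dead → dead _ enₜ))
  persists (not-fire t _) ¬¬enₜ avoid steps =
    invariant-along (¬¬-invariant (enabled-invariant t)) avoid steps ¬¬enₜ
  persists (not-cmp {o = o} _ i) ¬¬holds avoid steps ¬holds′ =
    persists i (λ nh → ¬¬holds (negOp-sound o _ _ nh)) avoid steps (negOp-complete o _ _ ¬holds′)
  persists (not-and _ i) ¬¬φ₁∧φ₂ avoid steps =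
    ¬[¬⊎¬]⇒¬¬× (persists i (contraposition ¬⊎¬⇒¬× ¬¬φ₁∧φ₂) avoid steps)
  persists (not-or _ i) ¬¬φ₁∨φ₂ avoid steps =
    ¬[¬×¬]⇒¬¬⊎ (persists i (contraposition (uncurry _¬-⊎_) ¬¬φ₁∨φ₂) avoid steps)
  persists (not-not _ i) ¬¬¬φ avoid steps =
    contradiction (persists i (negated-stable ¬¬¬φ) avoid steps)

lemma4p3 : (N : Game) (M : Marking N) (φ : Formula N) (S : TSet N) →
    Interesting N M φ S → ¬ (_⊨_ N M φ) →
    (w : List (Trans N)) (M' : Marking N) → All (λ t → ¬ S t) w →
    Steps N M w M' → ¬ (_⊨_ N M' φ)
lemma4p3 N _ _ _ 𝓘 M⊭φ _ _ avoid steps = persists N 𝓘 M⊭φ avoid steps
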